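{- Let $k\geq 0$. Define the arrays $t_k$ and $h_k$ by \[ x^kT_k(x)=\sum_{i=0}^{k+1}\sum_{j=0}^{k}t_k(i,j)x^{(k+1)i+j},\qquad H_k(x)=\sum_{i=0}^{k+1}\sum_{j=0}^{2k+1}h_k(i,j)x^{2(k+1)i+j}. \] Then $h_k$ is obtained by rotating $t_k$ by $180$ degrees and placing the rotated array in front of $t_k$; that is, for all $0\leq i\leq k+1$ and $0\leq j\leq k$, \[ h_k(i,j)=t_k(k+1-i,\,k-j)\quad\text{and}\quad h_k(i,\,k+1+j)=t_k(i,j). \]
   Context: $B_n$ is the set of signed permutations of $[n]$ (permutations with possible minus signs on entries); $\mathrm{des}_B(\pi)$ is the number of $i\in\{0,\dots,n-1\}$ with $\pi_i>\pi_{i+1}$ where $\pi_0=0$; $B_n(t)=\sum_{\pi\in B_n}t^{\mathrm{des}_B(\pi)}$ is the type $B$ Eulerian polynomial ($B_0=1$). Define \[ x^kT_k(x)=\sum_{l=0}^{k}B_{k-l}(x^{k+1})(x^{k+1}-1)^l\sum_{i=l}^{k}\binom{i}{l}x^{k-i}, \] \[ H_k(x)=\sum_{l=0}^{k}B_{k-l}(x^{2k+2})(x^{2k+2}-1)^l\sum_{s=l}^{k}\binom{s}{l}x^{2k+1-s}+\sum_{l=0}^{k}B_{k-l}(x^{ -2k-2})(x^{ -2k-2}-1)^l\sum_{s=l}^{k}\binom{s}{l}x^{2(k+1)^2+s}. \] -}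

module Defs where

open import Data.Nat as ℕ using (ℕ; zero; suc; _∸_)
open import Data.Nat.Combinatorics using (_C_)
open import Data.Integer as ℤ using (ℤ; +_; -_; -[1+_]; ∣_∣)
open import Data.Product using (_×_; _,_)
open import Data.List using (List; []; _∷_; map; concatMap; upTo; foldr; filter; _++_)
open import Relation.Nullary.Decidable using (does)
open import Data.Bool using (Bool; true; false; if_then_else_)
import Data.List.Relation.Unary.Unique.DecPropositional as UniqueDec

words : {A : Set} → List A → ℕ → List (List A)
words as zero    = [] ∷ []
words as (suc n) = concatMap (λ a → map (a ∷_) (words as n)) as

signedValues : ℕ → List ℤ
signedValues n = map (λ i → + suc i) (upTo n) ++ map (λ i → -[1+ i ]) (upTo n)

-- B_n : words of length n over ±[n] whose absolute values are pairwise distinct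
-- (hence |π| is a permutation of [n])
signedPerms : ℕ → List (List ℤ)
signedPerms n =
  filter (λ w → UniqueDec.unique? ℕ._≟_ (map ∣_∣ w)) (words (signedValues n) n)

descents : List ℤ → ℕ
descents []            = 0
descents (a ∷ [])      = 0
descents (a ∷ b ∷ w)   =
  (if does (b ℤ.<? a) then 1 else 0) ℕ.+ descents (b ∷ w)

desB : List ℤ → ℕ
desB π = descents (+ 0 ∷ π)

-- Laurent polynomials with integer coefficients, represented as a
-- formal sum of monomials (coefficient , exponent).

Poly : Set
Poly = List (ℤ × ℤ)

infixl 6 _⊕_
infixl 7 _⊗_
infixr 8 _^ᴾ_

coeff : Poly → ℤ → ℤ
coeff []             e = + 0
coeff ((c , e') ∷ p) e = (if does (e' ℤ.≟ e) then c else + 0) ℤ.+ coeff p e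

_⊕_ : Poly → Poly → Poly
p ⊕ q = p ++ q

_⊗_ : Poly → Poly → Poly
p ⊗ q = concatMap (λ { (c , e) → map (λ { (d , f) → (c ℤ.* d , e ℤ.+ f) }) q }) p

mono : ℤ → ℤ → Poly
mono c e = (c , e) ∷ []

one : Poly
one = mono (+ 1) (+ 0)

_^ᴾ_ : Poly → ℕ → Poly
p ^ᴾ zero  = one
p ^ᴾ suc n = p ⊗ (p ^ᴾ n)

subst : ℤ → Poly → Poly
subst m = map (λ { (c , e) → (c , m ℤ.* e) })

Σᴾ : List ℕ → (ℕ → Poly) → Poly
Σᴾ xs f = foldr (λ x acc → f x ⊕ acc) [] xs

-- the list [a, a+1, …, b]  (empty if b < a)
range : ℕ → ℕ → List ℕ
range a b = map (a ℕ.+_) (upTo (suc b ∸ a))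

Bpoly : ℕ → Poly
Bpoly n = map (λ π → (+ 1 , + desB π)) (signedPerms n)

xkTk : ℕ → Poly
xkTk k = Σᴾ (range 0 k) λ l →
  subst (+ (suc k)) (Bpoly (k ∸ l))
  ⊗ ((mono (+ 1) (+ (suc k)) ⊕ mono (- + 1) (+ 0)) ^ᴾ l)
  ⊗ Σᴾ (range l k) (λ i → mono (+ (i C l)) (+ (k ∸ i)))

Hk : ℕ → Poly
Hk k =
  Σᴾ (range 0 k) (λ l →
    subst (+ (2 ℕ.* suc k)) (Bpoly (k ∸ l))
    ⊗ ((mono (+ 1) (+ (2 ℕ.* suc k)) ⊕ mono (- + 1) (+ 0)) ^ᴾ l)
    ⊗ Σᴾ (range l k) (λ s → mono (+ (s C l)) (+ (2 ℕ.* k ℕ.+ 1 ∸ s))))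
  ⊕
  Σᴾ (range 0 k) (λ l →
    subst (- + (2 ℕ.* suc k)) (Bpoly (k ∸ l))
    ⊗ ((mono (+ 1) (- + (2 ℕ.* suc k)) ⊕ mono (- + 1) (+ 0)) ^ᴾ l)
    ⊗ Σᴾ (range l k) (λ s → mono (+ (s C l)) (+ (2 ℕ.* (suc k ℕ.* suc k) ℕ.+ s))))

tArr : ℕ → ℕ → ℕ → ℤ
tArr k i j = coeff (xkTk k) (+ (suc k ℕ.* i ℕ.+ j))

hArr : ℕ → ℕ → ℕ → ℤ
hArr k i j = coeff (Hk k) (+ (2 ℕ.* suc k ℕ.* i ℕ.+ j))

module Submission where

-- The l-th summand B_{k-l}(x^a) (x^a - 1)^l Σ_{s=l}^{k} C(s,l) x^(g s) of x^k T_k(x) has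
-- a = k+1 and g s = k-s; those of the two halves of H_k(x) have a = 2k+2, g s = 2k+1-s and
-- a = -(2k+2), g s = 2(k+1)²+s. The factor B_{k-l}(x^a) (x^a - 1)^l is a polynomial in x^a whose
-- coefficients do not depend on a, so the three sums expand into the same list of coefficients,
-- the monomial indexed by a term x^(a n) (n ∈ ℕ) of that factor and by s ≤ k having exponent
-- a n + g s.
-- Read as two digits in base k+1, resp. 2k+2, this exponent is (n , k-s) in x^k T_k,
-- (n , (k+1)+(k-s)) in the first half of H_k, and (i , s) with i + n = k+1 in the second.
-- Hence the first half of H_k fills the columns k+1, …, 2k+1 of h_k with t_k, and the second
-- fills the columns 0, …, k with t_k rotated by (i , j) ↦ (k+1-i , k-j).

open import Defs
open import Data.Nat using (ℕ; suc; _≤_; _+_; _∸_)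
open import Data.Product using (_×_)
open import Relation.Binary.PropositionalEquality using (_≡_)

open import Data.Nat as ℕ using (zero; _<_; _*_; NonZero; s≤s)
import Data.Nat.Properties as ℕ
open import Data.Nat.Combinatorics using (_C_)
open import Data.Nat.DivMod using (_%_; [m+kn]%n≡m%n; m<n⇒m%n≡m)
open import Data.Nat.Tactic.RingSolver as ℕ-Solver using ()
open import Data.Integer as ℤ using (ℤ; +_; -_)
import Data.Integer.Properties as ℤ
open import Data.Integer.Tactic.RingSolver as ℤ-Solver using ()
open import Data.List using (List; []; _∷_; _++_)
open import Data.List.Relation.Unary.All as All using (All; []; _∷_)
import Data.List.Relation.Unary.All.Properties as All
open import Data.List.Relation.Binary.Pointwise as Pointwise using (Pointwise; []; _∷_)
open import Data.Product using (_,_; proj₂; ∃-syntax)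
open import Data.Bool using (if_then_else_)
open import Function using (_⇔_; mk⇔; Equivalence)
import Function.Properties.Equivalence as ⇔
open import Relation.Binary.PropositionalEquality
  using (_≢_; refl; cong; cong₂; sym; trans; module ≡-Reasoning)
open import Relation.Nullary.Decidable using (does; does-⇔; dec-false)

Matching : ℤ → ℤ → ℤ × ℤ → ℤ × ℤ → Set
Matching e₁ e₂ (c₁ , f₁) (c₂ , f₂) = c₁ ≡ c₂ × (f₁ ≡ e₁ ⇔ f₂ ≡ e₂)

Avoids : ℤ → ℤ × ℤ → Set
Avoids e (c , f) = f ≢ e

monomial-coeff : ℤ × ℤ → ℤ → ℤ
monomial-coeff (c , f) e = if does (f ℤ.≟ e) then c else + 0

coeff-++ : ∀ p q e → coeff (p ++ q) e ≡ coeff p e ℤ.+ coeff q e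
coeff-++ []      q e = sym (ℤ.+-identityˡ (coeff q e))
coeff-++ (m ∷ p) q e =
  trans (cong₂ ℤ._+_ (refl {x = monomial-coeff m e}) (coeff-++ p q e))
        (sym (ℤ.+-assoc (monomial-coeff m e) (coeff p e) (coeff q e)))

coeff-Matching : ∀ {e₁ e₂ p q} → Pointwise (Matching e₁ e₂) p q → coeff p e₁ ≡ coeff q e₂
coeff-Matching [] = refl
coeff-Matching {e₁} {e₂} {(c , f₁) ∷ _} {(_ , f₂) ∷ _} ((refl , f₁≡e₁⇔f₂≡e₂) ∷ ms) =
  cong₂ ℤ._+_
    (cong (λ b → if b then c else + 0) (does-⇔ f₁≡e₁⇔f₂≡e₂ (f₁ ℤ.≟ e₁) (f₂ ℤ.≟ e₂)))
    (coeff-Matching ms)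

coeff-Avoids : ∀ {e p} → All (Avoids e) p → coeff p e ≡ + 0
coeff-Avoids [] = refl
coeff-Avoids {e} {(c , f) ∷ _} (f≢e ∷ as) =
  cong₂ ℤ._+_ (cong (λ b → if b then c else + 0) (dec-false (f ℤ.≟ e) f≢e)) (coeff-Avoids as)

⊗⁺ : ∀ {R S T : ℤ × ℤ → ℤ × ℤ → Set} →
     (∀ {c₁ e₁ c₂ e₂ d₁ f₁ d₂ f₂} → R (c₁ , e₁) (c₂ , e₂) → S (d₁ , f₁) (d₂ , f₂) →
        T (c₁ ℤ.* d₁ , e₁ ℤ.+ f₁) (c₂ ℤ.* d₂ , e₂ ℤ.+ f₂)) →
     ∀ {p₁ p₂ q₁ q₂} → Pointwise R p₁ p₂ → Pointwise S q₁ q₂ →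
     Pointwise T (p₁ ⊗ q₁) (p₂ ⊗ q₂)
⊗⁺ mul ps qs = Pointwise.concat⁺
  (Pointwise.map⁺ _ _ (Pointwise.map (λ r → Pointwise.map⁺ _ _ (Pointwise.map (mul r) qs)) ps))

Σᴾ⁺ : ∀ {R : ℤ × ℤ → ℤ × ℤ → Set} {xs f g} →
      All (λ x → Pointwise R (f x) (g x)) xs → Pointwise R (Σᴾ xs f) (Σᴾ xs g)
Σᴾ⁺ []       = []
Σᴾ⁺ (r ∷ rs) = Pointwise.++⁺ r (Σᴾ⁺ rs)

Pointwise⇒All : ∀ {A B : Set} {P : A → Set} {xs : List A} {ys : List B} →
                Pointwise (λ x _ → P x) xs ys → All P xs
Pointwise⇒All []       = []
Pointwise⇒All (p ∷ ps) = p ∷ Pointwise⇒All ps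

*-+-unique : ∀ d .{{_ : NonZero d}} {q₁ q₂ r₁ r₂} → r₁ < d → r₂ < d →
             (d * q₁ + r₁ ≡ d * q₂ + r₂) ⇔ (q₁ ≡ q₂ × r₁ ≡ r₂)
*-+-unique d {q₁} {q₂} {r₁} {r₂} r₁<d r₂<d = mk⇔ to λ { (refl , refl) → refl }
  where
  open ≡-Reasoning

  remainder : ∀ q r → r < d → (d * q + r) % d ≡ r
  remainder q r r<d = begin
    (d * q + r) % d ≡⟨ cong (_% d) (trans (ℕ.+-comm (d * q) r) (cong (r ℕ.+_) (ℕ.*-comm d q))) ⟩
    (r + q * d) % d ≡⟨ [m+kn]%n≡m%n r q d ⟩
    r % d           ≡⟨ m<n⇒m%n≡m r<d ⟩
    r               ∎

  to : d * q₁ + r₁ ≡ d * q₂ + r₂ → q₁ ≡ q₂ × r₁ ≡ r₂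
  to eq = ℕ.*-cancelˡ-≡ q₁ q₂ d (ℕ.+-cancelʳ-≡ r₁ _ _ (trans eq (cong (d * q₂ ℕ.+_) (sym r₁≡r₂))))
        , r₁≡r₂
    where
    r₁≡r₂ : r₁ ≡ r₂
    r₁≡r₂ = trans (sym (remainder q₁ r₁ r₁<d)) (trans (cong (_% d) eq) (remainder q₂ r₂ r₂<d))

pos-affine-≡⇔ : ∀ d q r e → (+ d ℤ.* + q ℤ.+ + r ≡ + e) ⇔ (d * q + r ≡ e)
pos-affine-≡⇔ d q r e rewrite sym (ℤ.pos-* d q) = mk⇔ ℤ.+-injective (cong (λ n → + n))

neg-affine-≡⇔ : ∀ d q r e → (- + d ℤ.* + q ℤ.+ + r ≡ + e) ⇔ (r ≡ e + d * q)
neg-affine-≡⇔ d q r e = mk⇔ to from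
  where
  open ≡-Reasoning

  add-back : ∀ a b y → y ≡ (- a ℤ.* b ℤ.+ y) ℤ.+ a ℤ.* b
  add-back = ℤ-Solver.solve-∀

  cancel : ∀ a b y → - a ℤ.* b ℤ.+ (y ℤ.+ a ℤ.* b) ≡ y
  cancel = ℤ-Solver.solve-∀

  to : - + d ℤ.* + q ℤ.+ + r ≡ + e → r ≡ e + d * q
  to eq = ℤ.+-injective (begin
    + r                                      ≡⟨ add-back (+ d) (+ q) (+ r) ⟩
    (- + d ℤ.* + q ℤ.+ + r) ℤ.+ + d ℤ.* + q  ≡⟨ cong₂ ℤ._+_ eq (sym (ℤ.pos-* d q)) ⟩
    + (e + d * q)                            ∎)

  from : r ≡ e + d * q → - + d ℤ.* + q ℤ.+ + r ≡ + e
  from refl = begin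
    - + d ℤ.* + q ℤ.+ + (e + d * q)          ≡⟨ cong (λ x → - + d ℤ.* + q ℤ.+ (+ e ℤ.+ x))
                                                     (ℤ.pos-* d q) ⟩
    - + d ℤ.* + q ℤ.+ (+ e ℤ.+ + d ℤ.* + q)  ≡⟨ cancel (+ d) (+ q) (+ e) ⟩
    + e                                      ∎

≡⇔≡ : ∀ {A : Set} {a a′ b b′ : A} → a ≡ a′ → b ≡ b′ → (a ≡ b) ⇔ (a′ ≡ b′)
≡⇔≡ refl refl = ⇔.refl

Scaled : ℤ → ℤ → ℤ × ℤ → ℤ × ℤ → Set
Scaled a₁ a₂ (c₁ , e₁) (c₂ , e₂) = c₁ ≡ c₂ × ∃[ n ] e₁ ≡ a₁ ℤ.* + n × e₂ ≡ a₂ ℤ.* + n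

Scaled-* : ∀ {a₁ a₂ c₁ e₁ c₂ e₂ d₁ f₁ d₂ f₂} →
           Scaled a₁ a₂ (c₁ , e₁) (c₂ , e₂) → Scaled a₁ a₂ (d₁ , f₁) (d₂ , f₂) →
           Scaled a₁ a₂ (c₁ ℤ.* d₁ , e₁ ℤ.+ f₁) (c₂ ℤ.* d₂ , e₂ ℤ.+ f₂)
Scaled-* {a₁} {a₂} (refl , m , refl , refl) (refl , n , refl , refl) =
  refl , m + n , sym (ℤ.*-distribˡ-+ a₁ (+ m) (+ n)) , sym (ℤ.*-distribˡ-+ a₂ (+ m) (+ n))

subst-Bpoly-Scaled : ∀ a₁ a₂ n →
  Pointwise (Scaled a₁ a₂) (subst a₁ (Bpoly n)) (subst a₂ (Bpoly n))
subst-Bpoly-Scaled a₁ a₂ n =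
  Pointwise.map⁺ _ _ (Pointwise.map⁺ _ _ (Pointwise.refl λ {π} → refl , desB π , refl , refl))

xᵃ-1 : ℤ → Poly
xᵃ-1 a = mono (+ 1) a ⊕ mono (- + 1) (+ 0)

xᵃ-1^-Scaled : ∀ a₁ a₂ l → Pointwise (Scaled a₁ a₂) (xᵃ-1 a₁ ^ᴾ l) (xᵃ-1 a₂ ^ᴾ l)
xᵃ-1^-Scaled a₁ a₂ zero    = (refl , 0 , sym (ℤ.*-zeroʳ a₁) , sym (ℤ.*-zeroʳ a₂)) ∷ []
xᵃ-1^-Scaled a₁ a₂ (suc l) = ⊗⁺ (Scaled-* {a₁} {a₂}) xᵃ-1-Scaled (xᵃ-1^-Scaled a₁ a₂ l)
  where
  xᵃ-1-Scaled : Pointwise (Scaled a₁ a₂) (xᵃ-1 a₁) (xᵃ-1 a₂)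
  xᵃ-1-Scaled = (refl , 1 , sym (ℤ.*-identityʳ a₁) , sym (ℤ.*-identityʳ a₂))
              ∷ (refl , 0 , sym (ℤ.*-zeroʳ a₁) , sym (ℤ.*-zeroʳ a₂)) ∷ []

Eulerian-factor-Scaled : ∀ a₁ a₂ n l →
  Pointwise (Scaled a₁ a₂) (subst a₁ (Bpoly n) ⊗ xᵃ-1 a₁ ^ᴾ l)
                           (subst a₂ (Bpoly n) ⊗ xᵃ-1 a₂ ^ᴾ l)
Eulerian-factor-Scaled a₁ a₂ n l =
  ⊗⁺ (Scaled-* {a₁} {a₂}) (subst-Bpoly-Scaled a₁ a₂ n) (xᵃ-1^-Scaled a₁ a₂ l)

range-≤ : ∀ l k → All (_≤ k) (range l k)
range-≤ l k = All.map⁺ (All.map (bound l k) (All.all-upTo (suc k ∸ l)))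
  where
  bound : ∀ l k {i} → i < suc k ∸ l → l + i ≤ k
  bound zero          k       (s≤s i≤k) = i≤k
  bound (suc l)       (suc k) i<k∸l     = s≤s (bound l k i<k∸l)
  bound (suc zero)    zero    ()
  bound (suc (suc l)) zero    ()

Shifted : ℕ → (ℕ → ℤ) → (ℕ → ℤ) → ℤ × ℤ → ℤ × ℤ → Set
Shifted k g₁ g₂ (c₁ , e₁) (c₂ , e₂) = c₁ ≡ c₂ × ∃[ s ] s ≤ k × e₁ ≡ g₁ s × e₂ ≡ g₂ s

binomial-sum-Shifted : ∀ k l g₁ g₂ →
  Pointwise (Shifted k g₁ g₂) (Σᴾ (range l k) (λ s → mono (+ (s C l)) (g₁ s)))
                              (Σᴾ (range l k) (λ s → mono (+ (s C l)) (g₂ s)))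
binomial-sum-Shifted k l g₁ g₂ =
  Σᴾ⁺ (All.map (λ {s} s≤k → (refl , s , s≤k , refl , refl) ∷ []) (range-≤ l k))

-- The l-th summand: xkTk k and both halves of Hk k unfold to Σᴾ (range 0 k) (block k a g).
block : ℕ → ℤ → (ℕ → ℤ) → ℕ → Poly
block k a g l =
  subst a (Bpoly (k ∸ l)) ⊗ xᵃ-1 a ^ᴾ l ⊗ Σᴾ (range l k) (λ s → mono (+ (s C l)) (g s))

blocks⁺ : ∀ {T : ℤ × ℤ → ℤ × ℤ → Set} k a₁ a₂ g₁ g₂ →
  (∀ c n s → s ≤ k → T (c , a₁ ℤ.* + n ℤ.+ g₁ s) (c , a₂ ℤ.* + n ℤ.+ g₂ s)) →
  Pointwise T (Σᴾ (range 0 k) (block k a₁ g₁)) (Σᴾ (range 0 k) (block k a₂ g₂))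
blocks⁺ {T} k a₁ a₂ g₁ g₂ hyp = Σᴾ⁺ (All.universal block⁺ (range 0 k))
  where
  combine : ∀ {c₁ e₁ c₂ e₂ d₁ f₁ d₂ f₂} →
            Scaled a₁ a₂ (c₁ , e₁) (c₂ , e₂) → Shifted k g₁ g₂ (d₁ , f₁) (d₂ , f₂) →
            T (c₁ ℤ.* d₁ , e₁ ℤ.+ f₁) (c₂ ℤ.* d₂ , e₂ ℤ.+ f₂)
  combine {c₁} {d₁ = d₁} (refl , n , refl , refl) (refl , s , s≤k , refl , refl) =
    hyp (c₁ ℤ.* d₁) n s s≤k

  block⁺ : ∀ l → Pointwise T (block k a₁ g₁ l) (block k a₂ g₂ l)
  block⁺ l =
    ⊗⁺ combine (Eulerian-factor-Scaled a₁ a₂ (k ∸ l) l) (binomial-sum-Shifted k l g₁ g₂)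

blocks-All : ∀ {P : ℤ × ℤ → Set} k a g →
  (∀ c n s → s ≤ k → P (c , a ℤ.* + n ℤ.+ g s)) → All P (Σᴾ (range 0 k) (block k a g))
blocks-All {P} k a g hyp =
  Pointwise⇒All (blocks⁺ {T = λ m (_ : ℤ × ℤ) → P m} k a a g g hyp)

lower-digit< : ∀ k {r} → r ≤ k → r < 2 * suc k
lower-digit< k r≤k = ℕ.≤-trans (s≤s r≤k) (ℕ.m≤m+n (suc k) _)

upper-digit< : ∀ k {r} → r ≤ k → suc k + r < 2 * suc k
upper-digit< k r≤k = ℕ.+-monoʳ-< (suc k) (ℕ.≤-trans (s≤s r≤k) (ℕ.m≤m+n (suc k) 0))

t-exponent-≡⇔ : ∀ k {n s i j} → j ≤ k →
  (+ suc k ℤ.* + n ℤ.+ + (k ∸ s) ≡ + (suc k * i + j)) ⇔ (n ≡ i × k ∸ s ≡ j)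
t-exponent-≡⇔ k {n} {s} {i} {j} j≤k =
  ⇔.trans (pos-affine-≡⇔ (suc k) n (k ∸ s) (suc k * i + j))
          (*-+-unique (suc k) (s≤s (ℕ.m∸n≤m k s)) (s≤s j≤k))

Hk-right-exponent-≡⇔ : ∀ k {n s i j} → s ≤ k → j < 2 * suc k →
  (+ (2 * suc k) ℤ.* + n ℤ.+ + (2 * k + 1 ∸ s) ≡ + (2 * suc k * i + j))
  ⇔ (n ≡ i × suc k + (k ∸ s) ≡ j)
Hk-right-exponent-≡⇔ k {n} {s} {i} {j} s≤k j<M =
  ⇔.trans (pos-affine-≡⇔ (2 * suc k) n (2 * k + 1 ∸ s) (2 * suc k * i + j))
  (⇔.trans (≡⇔≡ (cong (2 * suc k * n ℕ.+_) odd∸s) refl)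
           (*-+-unique (2 * suc k) (upper-digit< k (ℕ.m∸n≤m k s)) j<M))
  where
  odd∸s : 2 * k + 1 ∸ s ≡ suc k + (k ∸ s)
  odd∸s = trans (cong (_∸ s) (twice+1 k)) (ℕ.+-∸-assoc (suc k) s≤k)
    where
    twice+1 : ∀ m → 2 * m + 1 ≡ suc m + m
    twice+1 = ℕ-Solver.solve-∀

Hk-left-exponent-≡⇔ : ∀ k {n s i j} → s ≤ k → j < 2 * suc k →
  (- + (2 * suc k) ℤ.* + n ℤ.+ + (2 * (suc k * suc k) + s) ≡ + (2 * suc k * i + j))
  ⇔ (suc k ≡ i + n × s ≡ j)
Hk-left-exponent-≡⇔ k {n} {s} {i} {j} s≤k j<M =
  ⇔.trans (neg-affine-≡⇔ (2 * suc k) n (2 * (suc k * suc k) + s) (2 * suc k * i + j))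
  (⇔.trans (≡⇔≡ (cong (ℕ._+ s) (sym (ℕ.*-assoc 2 (suc k) (suc k))))
                (regroup (2 * suc k) i j n))
           (*-+-unique (2 * suc k) (lower-digit< k s≤k) j<M))
  where
  regroup : ∀ d i j n → d * i + j + d * n ≡ d * (i + n) + j
  regroup = ℕ-Solver.solve-∀

reflect-digits : ∀ {k i j n s} → i ≤ suc k → j ≤ k → s ≤ k →
  (suc k ≡ i + n × s ≡ j) ⇔ (n ≡ suc k ∸ i × k ∸ s ≡ k ∸ j)
reflect-digits {k} {i} {j} {n} {s} i≤1+k j≤k s≤k = mk⇔
  (λ { (1+k≡i+n , refl) → trans (sym (ℕ.m+n∸m≡n i n)) (cong (_∸ i) (sym 1+k≡i+n)) , refl })
  (λ { (refl , k∸s≡k∸j) → sym (ℕ.m+[n∸m]≡n i≤1+k) , ℕ.∸-cancelˡ-≡ s≤k j≤k k∸s≡k∸j })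

shift-digits : ∀ {k i j n s : ℕ} →
  (n ≡ i × suc k + (k ∸ s) ≡ suc k + j) ⇔ (n ≡ i × k ∸ s ≡ j)
shift-digits {k} {j = j} {s = s} = mk⇔
  (λ { (n≡i , eq) → n≡i , ℕ.+-cancelˡ-≡ (suc k) (k ∸ s) j eq })
  (λ { (n≡i , eq) → n≡i , cong (suc k ℕ.+_) eq })

upper-digit≢lower : ∀ {k r j} → j ≤ k → suc k + r ≢ j
upper-digit≢lower {k} {r} j≤k eq =
  ℕ.<⇒≱ (s≤s j≤k) (ℕ.≤-trans (ℕ.m≤m+n (suc k) r) (ℕ.≤-reflexive eq))

Hk-right Hk-left : ℕ → Poly
Hk-right k = Σᴾ (range 0 k) (block k (+ (2 * suc k)) (λ s → + (2 * k + 1 ∸ s)))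
Hk-left  k = Σᴾ (range 0 k) (block k (- + (2 * suc k)) (λ s → + (2 * (suc k * suc k) + s)))

coeff-Hk : ∀ k e → coeff (Hk k) e ≡ coeff (Hk-right k) e ℤ.+ coeff (Hk-left k) e
coeff-Hk k = coeff-++ (Hk-right k) (Hk-left k)

Hk-right-avoids-left : ∀ k i {j} → j ≤ k →
  coeff (Hk-right k) (+ (2 * suc k * i + j)) ≡ + 0
Hk-right-avoids-left k i j≤k =
  coeff-Avoids (blocks-All k (+ (2 * suc k)) (λ s → + (2 * k + 1 ∸ s)) λ c n s s≤k eq →
    upper-digit≢lower j≤k
      (proj₂ (Equivalence.to (Hk-right-exponent-≡⇔ k {n} {s} s≤k (lower-digit< k j≤k)) eq)))

Hk-left-avoids-right : ∀ k i {j} → j ≤ k →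
  coeff (Hk-left k) (+ (2 * suc k * i + (suc k + j))) ≡ + 0
Hk-left-avoids-right k i j≤k =
  coeff-Avoids (blocks-All k (- + (2 * suc k)) (λ s → + (2 * (suc k * suc k) + s)) λ c n s s≤k eq →
    upper-digit≢lower s≤k
      (sym (proj₂ (Equivalence.to (Hk-left-exponent-≡⇔ k {n} {s} s≤k (upper-digit< k j≤k)) eq))))

Hk-left-reflects : ∀ k {i j} → i ≤ suc k → j ≤ k →
  coeff (Hk-left k) (+ (2 * suc k * i + j)) ≡ tArr k (suc k ∸ i) (k ∸ j)
Hk-left-reflects k {j = j} i≤1+k j≤k =
  coeff-Matching (blocks⁺ k _ _ _ _ λ c n s s≤k → refl ,
    ⇔.trans (Hk-left-exponent-≡⇔ k {n} {s} s≤k (lower-digit< k j≤k))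
    (⇔.trans (reflect-digits {n = n} {s} i≤1+k j≤k s≤k)
             (⇔.sym (t-exponent-≡⇔ k {n} {s} (ℕ.m∸n≤m k j)))))

Hk-right-shifts : ∀ k {i j} → j ≤ k →
  coeff (Hk-right k) (+ (2 * suc k * i + (suc k + j))) ≡ tArr k i j
Hk-right-shifts k j≤k =
  coeff-Matching (blocks⁺ k _ _ _ _ λ c n s s≤k → refl ,
    ⇔.trans (Hk-right-exponent-≡⇔ k {n} {s} s≤k (upper-digit< k j≤k))
    (⇔.trans (shift-digits {s = s}) (⇔.sym (t-exponent-≡⇔ k {n} {s} j≤k))))

lemma3p1 : (k i j : ℕ) → i ≤ suc k → j ≤ k →
    (hArr k i j ≡ tArr k (suc k ∸ i) (k ∸ j)) × (hArr k i (suc k + j) ≡ tArr k i j)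
lemma3p1 k i j i≤1+k j≤k = reflected , shifted
  where
  open ≡-Reasoning

  reflected : hArr k i j ≡ tArr k (suc k ∸ i) (k ∸ j)
  reflected = begin
    hArr k i j                                    ≡⟨ coeff-Hk k _ ⟩
    coeff (Hk-right k) _ ℤ.+ coeff (Hk-left k) _  ≡⟨ cong₂ ℤ._+_ (Hk-right-avoids-left k i j≤k)
                                                                 (Hk-left-reflects k i≤1+k j≤k) ⟩
    + 0 ℤ.+ tArr k (suc k ∸ i) (k ∸ j)            ≡⟨ ℤ.+-identityˡ _ ⟩
    tArr k (suc k ∸ i) (k ∸ j)                    ∎

  shifted : hArr k i (suc k + j) ≡ tArr k i j
  shifted = begin
    hArr k i (suc k + j)                          ≡⟨ coeff-Hk k _ ⟩
    coeff (Hk-right k) _ ℤ.+ coeff (Hk-left k) _  ≡⟨ cong₂ ℤ._+_ (Hk-right-shifts k j≤k)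
                                                                 (Hk-left-avoids-right k i j≤k) ⟩
    tArr k i j ℤ.+ + 0                            ≡⟨ ℤ.+-identityʳ _ ⟩
    tArr k i j                                    ∎
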